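{- Let $K$ be a commutative, $+$-positive semiring, let $\mathcal G=(V,V_0,V_1,T,E)$ be a finite acyclic game graph, and let $f_0,f_1:V\to K$ be the $K$-valuations of the two players induced by basic valuations $f_\sigma:T\to K$ and $h_\sigma:E\to K\setminus\{0\}$ ($\sigma=0,1$). If $f_0,f_1$ are separating on $T$, then they are separating on all of $V$; and if $f_0,f_1$ are weakly separating on $T$, then they are weakly separating on all of $V$.
   Context: A game graph is $\mathcal G=(V,V_0,V_1,T,E)$ where $V$ is the disjoint union of $V_0$ (positions of Player 0), $V_1$ (positions of Player 1) and $T$ (terminal positions), $E\subseteq V\times V$, $vE=\{w:(v,w)\in E\}$, $vE=\emptyset$ iff $v\in T$. For each $\sigma$, $f_\sigma$ extends to $V$ by backward induction: $f_\sigma(v)=\sum_{w\in vE}h_\sigma(vw)f_\sigma(w)$ if $v\in V_\sigma$ and $f_\sigma(v)=\prod_{w\in vE}h_\sigma(vw)f_\sigma(w)$ if $v\in V_{1-\sigma}$. $+$-positive means $a+b=0$ implies $a=b=0$. For $U\subseteq V$: $f_0,f_1$ are separating on $U$ if for every $u\in U$, $f_0(u)=0$ or $f_1(u)=0$; they are weakly separating on $U$ if $f_0(u)\cdot f_1(u)=0$ for all $u\in U$. Throughout, semirings are also root-integral ($a\cdot a=0$ implies $a=0$). -}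

module Defs where

open import Level using (Level; _⊔_)
open import Data.Nat using (ℕ; zero; suc)
open import Data.Fin using (Fin; zero; suc)
open import Data.Bool using (Bool; true; false; if_then_else_)
open import Data.Product using (_×_)
open import Data.Sum using (_⊎_)
open import Data.Unit using (⊤)
open import Relation.Nullary using (¬_)
open import Relation.Binary.PropositionalEquality using (_≡_)
open import Relation.Binary.Construct.Closure.Transitive using (TransClosure)
open import Algebra.Bundles using (CommutativeSemiring)

-- Players are σ ∈ Fin 2 (zero = Player 0, suc zero = Player 1).
opp : Fin 2 → Fin 2
opp zero = suc zero
opp (suc _) = zero

-- Kind of a position: owned by a player (V₀ or V₁), or terminal (T).
data Kind : Set where
  own      : Fin 2 → Kind
  terminal : Kind

record GameGraph (n : ℕ) : Set where
  field
    kind : Fin n → Kind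
    E    : Fin n → Fin n → Bool
    terminal-no-succ : ∀ v → kind v ≡ terminal → ∀ w → E v w ≡ false
    succ-if-nonterm  : ∀ v → ¬ (kind v ≡ terminal) → ¬ (∀ w → E v w ≡ false)

Acyclic : ∀ {n} → GameGraph n → Set
Acyclic {n} G = ∀ (v : Fin n) → ¬ TransClosure (λ x y → GameGraph.E G x y ≡ true) v v

module _ {c ℓ : Level} (K : CommutativeSemiring c ℓ) where
  open CommutativeSemiring K using (Carrier; _≈_; _+_; _*_; 0#; 1#)

  PlusPositive : Set (c ⊔ ℓ)
  PlusPositive = ∀ a b → a + b ≈ 0# → (a ≈ 0#) × (b ≈ 0#)

  RootIntegral : Set (c ⊔ ℓ)
  RootIntegral = ∀ a → a * a ≈ 0# → a ≈ 0#

  sumF : ∀ {n} → (Fin n → Carrier) → Carrier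
  sumF {zero}  g = 0#
  sumF {suc n} g = g zero + sumF (λ i → g (suc i))

  prodF : ∀ {n} → (Fin n → Carrier) → Carrier
  prodF {zero}  g = 1#
  prodF {suc n} g = g zero * prodF (λ i → g (suc i))

  module _ {n : ℕ} (G : GameGraph n) where
    open GameGraph G

    succSum : (Fin n → Fin n → Carrier) → (Fin n → Carrier) → Fin n → Carrier
    succSum h f v = sumF (λ w → if E v w then h v w * f w else 0#)

    succProd : (Fin n → Fin n → Carrier) → (Fin n → Carrier) → Fin n → Carrier
    succProd h f v = prodF (λ w → if E v w then h v w * f w else 1#)

    EdgeValuationNonzero : (Fin 2 → Fin n → Fin n → Carrier) → Set ℓ
    EdgeValuationNonzero h = ∀ σ v w → E v w ≡ true → ¬ (h σ v w ≈ 0#)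

    -- f σ : V → K is the extension of its restriction to T by backward induction
    IsValuation : (Fin 2 → Fin n → Fin n → Carrier) → (Fin 2 → Fin n → Carrier) → Set ℓ
    IsValuation h f = ∀ σ v →
        (kind v ≡ own σ       → f σ v ≈ succSum  (h σ) (f σ) v)
      × (kind v ≡ own (opp σ) → f σ v ≈ succProd (h σ) (f σ) v)

    Separating : (Fin 2 → Fin n → Carrier) → (Fin n → Set) → Set (ℓ)
    Separating f U = ∀ u → U u → (f zero u ≈ 0#) ⊎ (f (suc zero) u ≈ 0#)

    WeaklySeparating : (Fin 2 → Fin n → Carrier) → (Fin n → Set) → Set (ℓ)
    WeaklySeparating f U = ∀ u → U u → f zero u * f (suc zero) u ≈ 0#

    IsT : Fin n → Set
    IsT v = kind v ≡ terminal

    AllV : Fin n → Set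
    AllV _ = ⊤

-- A position owned by σ gets f σ as a sum and f (1 − σ) as a product over the same
-- successors.  If every successor has a zero coordinate, either all summands vanish or
-- some factor does; and if every successor has f 0 · f 1 = 0, then expanding the sum
-- pairs each summand with a factor of the product, so every term of the expansion
-- vanishes.  Acyclicity makes the converse edge relation well founded, so backward
-- induction carries both properties from the terminal positions to all of V.  Neither
-- argument uses +-positivity, root-integrality or h ≠ 0.
module Submission where

open import Defs
open import Level using (Level)
open import Data.Nat using (ℕ)
open import Data.Fin using (Fin)
open import Data.Product using (_×_)
open import Algebra.Bundles using (CommutativeSemiring)

import Data.Nat as ℕ
open import Data.Nat.Properties using (n<1+n)
open import Data.Fin using (zero; suc; _<_)
open import Data.Fin.Properties using (pigeonhole)
open import Data.Product using (∃; _,_; proj₁; proj₂)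
open import Data.Sum using (_⊎_; inj₁; inj₂)
import Data.Sum as Sum
open import Data.Bool using (Bool; true; false; if_then_else_)
open import Data.Empty using (⊥-elim)
open import Function using (flip)
open import Relation.Nullary using (¬_)
open import Relation.Binary.Core using (Rel)
open import Relation.Binary.PropositionalEquality using (_≡_; subst)
import Relation.Binary.PropositionalEquality as ≡
open import Relation.Binary.Construct.Closure.Transitive using (TransClosure; [_]; _∷_)
open import Induction.WellFounded using (WellFounded; Acc; acc; module All)

module _ {n : ℕ} {r : Level} (_⟶_ : Rel (Fin n) r) where

  data Walk : ℕ → Fin n → Set r where
    stop : ∀ {v} → Walk 0 v
    step : ∀ {k u v} → u ⟶ v → Walk k v → Walk (ℕ.suc k) u

  vertex : ∀ {k v} → Walk k v → Fin (ℕ.suc k) → Fin n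
  vertex {v = v} _ zero    = v
  vertex (step _ p) (suc i) = vertex p i

  walk-start-reaches : ∀ {k v} (p : Walk k v) (j : Fin k) →
                       TransClosure _⟶_ v (vertex p (suc j))
  walk-start-reaches (step e _) zero    = [ e ]
  walk-start-reaches (step e p) (suc j) = e ∷ walk-start-reaches p j

  walk-reaches : ∀ {k v} (p : Walk k v) {i j : Fin (ℕ.suc k)} → i < j →
                 TransClosure _⟶_ (vertex p i) (vertex p j)
  walk-reaches p          {zero}  {suc j} _           = walk-start-reaches p j
  walk-reaches (step _ p) {suc i} {suc j} (ℕ.s≤s i<j) = walk-reaches p i<j

  long-walk⇒cycle : ∀ {v} → Walk n v → ∃ λ u → TransClosure _⟶_ u u
  long-walk⇒cycle p with i , j , i<j , same ← pigeonhole (n<1+n n) (vertex p) =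
    vertex p j , subst (λ u → TransClosure _⟶_ u (vertex p j)) same (walk-reaches p i<j)

  no-walk⇒acc : ∀ k {v} → ¬ Walk k v → Acc (flip _⟶_) v
  no-walk⇒acc ℕ.zero    ¬p = ⊥-elim (¬p stop)
  no-walk⇒acc (ℕ.suc k) ¬p = acc λ e → no-walk⇒acc k (λ p → ¬p (step e p))

  acyclic⇒wellFounded : (∀ v → ¬ TransClosure _⟶_ v v) → WellFounded (flip _⟶_)
  acyclic⇒wellFounded acyclic v =
    no-walk⇒acc n λ p → let u , cycle = long-walk⇒cycle p in acyclic u cycle

module _ {c ℓ : Level} (K : CommutativeSemiring c ℓ) where
  open CommutativeSemiring K hiding (zero)
  open import Relation.Binary.Reasoning.Setoid setoid

  sumF≈0⊎prodF≈0 : ∀ {m} (a b : Fin m → Carrier) → (∀ i → a i ≈ 0# ⊎ b i ≈ 0#) →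
                   sumF K a ≈ 0# ⊎ prodF K b ≈ 0#
  sumF≈0⊎prodF≈0 {ℕ.zero}  a b zero-at = inj₁ refl
  sumF≈0⊎prodF≈0 {ℕ.suc m} a b zero-at with zero-at zero
  ... | inj₂ b₀≈0 = inj₂ (trans (*-congʳ b₀≈0) (zeroˡ _))
  ... | inj₁ a₀≈0 = Sum.map (λ s≈0 → trans (+-cong a₀≈0 s≈0) (+-identityˡ 0#))
                            (λ p≈0 → trans (*-congˡ p≈0) (zeroʳ _))
                            (sumF≈0⊎prodF≈0 (λ i → a (suc i)) (λ i → b (suc i))
                                            (λ i → zero-at (suc i)))

  sumF*prodF≈0 : ∀ {m} (a b : Fin m → Carrier) → (∀ i → a i * b i ≈ 0#) →
                 sumF K a * prodF K b ≈ 0#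
  sumF*prodF≈0 {ℕ.zero}  a b ab≈0 = zeroˡ _
  sumF*prodF≈0 {ℕ.suc m} a b ab≈0 = begin
    (a zero + S) * (b zero * P)              ≈⟨ distribʳ _ _ _ ⟩
    a zero * (b zero * P) + S * (b zero * P) ≈⟨ +-cong (sym (*-assoc _ _ _)) (*-congˡ (*-comm _ _)) ⟩
    a zero * b zero * P + S * (P * b zero)   ≈⟨ +-cong (*-congʳ (ab≈0 zero)) (sym (*-assoc _ _ _)) ⟩
    0# * P + S * P * b zero                  ≈⟨ +-cong (zeroˡ _) (*-congʳ tail≈0) ⟩
    0# + 0# * b zero                         ≈⟨ +-identityˡ _ ⟩
    0# * b zero                              ≈⟨ zeroˡ _ ⟩
    0#                                       ∎
    where
    S P : Carrier
    S = sumF K (λ i → a (suc i))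
    P = prodF K (λ i → b (suc i))
    tail≈0 : S * P ≈ 0#
    tail≈0 = sumF*prodF≈0 (λ i → a (suc i)) (λ i → b (suc i)) (λ i → ab≈0 (suc i))

module _ {c ℓ : Level} (K : CommutativeSemiring c ℓ) {n : ℕ} (G : GameGraph n) where
  open CommutativeSemiring K hiding (zero)
  open import Algebra.Properties.CommutativeSemigroup *-commutativeSemigroup
    using (interchange)
  open GameGraph G

  _⟶_ : Rel (Fin n) _
  v ⟶ w = E v w ≡ true

  module _ (k k′ : Fin n → Fin n → Carrier) (g g′ : Fin n → Carrier) (v : Fin n) where

    succSum≈0⊎succProd≈0 : (∀ w → v ⟶ w → g w ≈ 0# ⊎ g′ w ≈ 0#) →
                           succSum K G k g v ≈ 0# ⊎ succProd K G k′ g′ v ≈ 0#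
    succSum≈0⊎succProd≈0 zero-at = sumF≈0⊎prodF≈0 K _ _ λ w → term w (E v w) (zero-at w)
      where
      term : ∀ w (b : Bool) → (b ≡ true → g w ≈ 0# ⊎ g′ w ≈ 0#) →
             (if b then k v w * g w else 0#) ≈ 0# ⊎ (if b then k′ v w * g′ w else 1#) ≈ 0#
      term w false _       = inj₁ refl
      term w true  zero-at = Sum.map (λ g≈0 → trans (*-congˡ g≈0) (zeroʳ _))
                                     (λ g′≈0 → trans (*-congˡ g′≈0) (zeroʳ _))
                                     (zero-at ≡.refl)

    succSum*succProd≈0 : (∀ w → v ⟶ w → g w * g′ w ≈ 0#) →
                         succSum K G k g v * succProd K G k′ g′ v ≈ 0#
    succSum*succProd≈0 gg′≈0 = sumF*prodF≈0 K _ _ λ w → term w (E v w) (gg′≈0 w)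
      where
      term : ∀ w (b : Bool) → (b ≡ true → g w * g′ w ≈ 0#) →
             (if b then k v w * g w else 0#) * (if b then k′ v w * g′ w else 1#) ≈ 0#
      term w false _     = zeroˡ _
      term w true  gg′≈0 = trans (interchange _ _ _ _)
                                 (trans (*-congˡ (gg′≈0 ≡.refl)) (zeroʳ _))

  module _ (h : Fin 2 → Fin n → Fin n → Carrier) (f : Fin 2 → Fin n → Carrier)
           (valuation : IsValuation K G h f) where

    owner-sum : ∀ σ {v} → kind v ≡ own σ → f σ v ≈ succSum K G (h σ) (f σ) v
    owner-sum σ {v} = proj₁ (valuation σ v)

    opponent-prod : ∀ σ {v} → kind v ≡ own (opp σ) → f σ v ≈ succProd K G (h σ) (f σ) v
    opponent-prod σ {v} = proj₂ (valuation σ v)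

    SeparatedAt : Fin n → Set ℓ
    SeparatedAt v = f zero v ≈ 0# ⊎ f (suc zero) v ≈ 0#

    WeaklySeparatedAt : Fin n → Set ℓ
    WeaklySeparatedAt v = f zero v * f (suc zero) v ≈ 0#

    separated-step : Separating K G f (IsT K G) →
                     ∀ v → (∀ {w} → v ⟶ w → SeparatedAt w) → SeparatedAt v
    separated-step sepT v ih with kind v in kind-v
    ... | terminal       = sepT v kind-v
    ... | own zero       =
      Sum.map (trans (owner-sum zero kind-v)) (trans (opponent-prod (suc zero) kind-v))
        (succSum≈0⊎succProd≈0 (h zero) (h (suc zero)) (f zero) (f (suc zero)) v λ _ → ih)
    ... | own (suc zero) = Sum.swap
      (Sum.map (trans (owner-sum (suc zero) kind-v)) (trans (opponent-prod zero kind-v))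
        (succSum≈0⊎succProd≈0 (h (suc zero)) (h zero) (f (suc zero)) (f zero) v
          λ _ e → Sum.swap (ih e)))

    weakly-separated-step : WeaklySeparating K G f (IsT K G) →
                            ∀ v → (∀ {w} → v ⟶ w → WeaklySeparatedAt w) → WeaklySeparatedAt v
    weakly-separated-step wsepT v ih with kind v in kind-v
    ... | terminal       = wsepT v kind-v
    ... | own zero       =
      trans (*-cong (owner-sum zero kind-v) (opponent-prod (suc zero) kind-v))
        (succSum*succProd≈0 (h zero) (h (suc zero)) (f zero) (f (suc zero)) v λ _ → ih)
    ... | own (suc zero) =
      trans (*-comm _ _)
        (trans (*-cong (owner-sum (suc zero) kind-v) (opponent-prod zero kind-v))
          (succSum*succProd≈0 (h (suc zero)) (h zero) (f (suc zero)) (f zero) v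
            λ _ e → trans (*-comm _ _) (ih e)))

mainTheorem6 : {c ℓ : Level} (K : CommutativeSemiring c ℓ)
    → PlusPositive K → RootIntegral K
    → {n : ℕ} (G : GameGraph n) → Acyclic G
    → (h : Fin 2 → Fin n → Fin n → CommutativeSemiring.Carrier K)
    → (f : Fin 2 → Fin n → CommutativeSemiring.Carrier K)
    → EdgeValuationNonzero K G h
    → IsValuation K G h f
    → (Separating K G f (IsT K G) → Separating K G f (AllV K G))
      × (WeaklySeparating K G f (IsT K G) → WeaklySeparating K G f (AllV K G))
mainTheorem6 K _ _ G acyclic h f _ valuation =
    (λ sepT u _ → wfRec _ (separated-step K G h f valuation sepT) u)
  , (λ wsepT u _ → wfRec _ (weakly-separated-step K G h f valuation wsepT) u)
  where open All (acyclic⇒wellFounded (_⟶_ K G) acyclic) _
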